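{- Let $n,k,t$ be positive integers with $t\ge n$ and $\frac{n(n+1)}{2}=k\cdot t$. If $\rho(n,k,t)=s^{\ell}x$ with $x\in\{ge,go\}$ and $\ell\ge 0$, then $\ell\le \frac{n}{2k}$.
   Context: The algorithm $\Pi\mathit{Solve}(n,k,t)$, on an instance $(n,k,t)$ of positive integers with $t\ge n$ and $n(n+1)/2=kt$, tests the following cases in order: case $m$: if $2k\mid n$ or $2k\mid n+1$, it solves the instance directly (meander algorithm) and stops; case $s$: else if $t\ge 2n$, it recurses on $(n-2k,\ k,\ t-2(n-k)-1)$; case $ge$: else if $t<2n$ and $t$ even, it recurses on $(t-n-1,\ 2(k-n)+t-1,\ t/2)$; case $go$: else ($t<2n$, $t$ odd) it recurses on $(t-n-1,\ k-\frac{2n-t+1}{2},\ t)$. The run sequence $\rho'(n,k,t)\in\{m,s,ge,go\}^+$ is the sequence of case symbols of the successive calls, starting with the call on $(n,k,t)$; it ends with $m$. $\rho(n,k,t)$ denotes $\rho'(n,k,t)$ with its last symbol removed; $s^\ell$ denotes $\ell$ consecutive symbols $s$. -}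

module Defs where

open import Data.Nat using (ℕ; _+_; _*_; _<_; _≤_)
open import Data.Nat.Divisibility using (_∣_)
open import Data.List using (List; []; _∷_)
open import Relation.Nullary using (¬_)
open import Relation.Binary.PropositionalEquality using (_≡_)
open import Data.Sum using (_⊎_)

-- Case symbols of the algorithm ΠSolve.
data Sym : Set where
  m s ge go : Sym

-- Run n k t r : r is the run sequence ρ'(n,k,t) of ΠSolve on (n,k,t).
-- Recursive-call arguments are given through equations that avoid
-- truncated subtraction:
--   s  : n' = n - 2k,            t' = t - 2(n-k) - 1
--   ge : n' = t - n - 1,         k' = 2(k-n) + t - 1,   t' = t/2
--   go : n' = t - n - 1,         k' = k - (2n - t + 1)/2,  t' = t
data Run : ℕ → ℕ → ℕ → List Sym → Set where
  run-m  : ∀ {n k t} →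
           (2 * k ∣ n) ⊎ (2 * k ∣ n + 1) →
           Run n k t (m ∷ [])
  run-s  : ∀ {n k t n' t' r} →
           ¬ (2 * k ∣ n) → ¬ (2 * k ∣ n + 1) →
           2 * n ≤ t →
           n' + 2 * k ≡ n →
           t' + 2 * n + 1 ≡ t + 2 * k →
           Run n' k t' r →
           Run n k t (s ∷ r)
  run-ge : ∀ {n k t n' k' t' r} →
           ¬ (2 * k ∣ n) → ¬ (2 * k ∣ n + 1) →
           t < 2 * n → 2 ∣ t →
           n' + n + 1 ≡ t →
           k' + 2 * n + 1 ≡ 2 * k + t →
           2 * t' ≡ t →
           Run n' k' t' r →
           Run n k t (ge ∷ r)
  run-go : ∀ {n k t n' k' r} →
           ¬ (2 * k ∣ n) → ¬ (2 * k ∣ n + 1) →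
           t < 2 * n → ¬ (2 ∣ t) →
           n' + n + 1 ≡ t →
           2 * k' + 2 * n + 1 ≡ 2 * k + t →
           Run n' k' t r →
           Run n k t (go ∷ r)

module Submission where

-- Each case-s call of ΠSolve keeps k and replaces n by n - 2k, while n
-- itself never drops below 0.  Hence a run that begins with ℓ symbols s
-- starts from an n of size at least 2k·ℓ.

open import Defs
open import Data.Nat using (ℕ; zero; suc; _+_; _*_; _<_; _≤_; z≤n)
open import Data.Nat.Properties using (*-zeroʳ; *-suc; +-comm; +-monoʳ-≤; ≤-reflexive; ≤-trans; module ≤-Reasoning)
open import Data.List using ([]; _∷_; _++_; replicate)
open import Data.Sum using (_⊎_)
open import Relation.Binary.PropositionalEquality using (_≡_; trans)

s-prefix-bound : ∀ ℓ {n k t r} → Run n k t (replicate ℓ s ++ r) → 2 * k * ℓ ≤ n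
s-prefix-bound zero {n} {k} _ = ≤-trans (≤-reflexive (*-zeroʳ (2 * k))) z≤n
s-prefix-bound (suc ℓ) {n} {k} (run-s {n' = n'} _ _ _ n'+2k≡n _ rest) = begin
  2 * k * suc ℓ    ≡⟨ *-suc (2 * k) ℓ ⟩
  2 * k + 2 * k * ℓ ≤⟨ +-monoʳ-≤ (2 * k) (s-prefix-bound ℓ rest) ⟩
  2 * k + n'        ≡⟨ trans (+-comm (2 * k) n') n'+2k≡n ⟩
  n                 ∎
  where open ≤-Reasoning

lemma8 : (n k t : ℕ) → 0 < n → 0 < k → 0 < t → n ≤ t →
         n * (n + 1) ≡ 2 * (k * t) →
         (ℓ : ℕ) (x : Sym) → (x ≡ ge ⊎ x ≡ go) →
         Run n k t (replicate ℓ s ++ x ∷ m ∷ []) →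
         2 * k * ℓ ≤ n
lemma8 n k t _ _ _ _ _ ℓ x _ run = s-prefix-bound ℓ run
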